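{- For all positive integers $a,b$ with $a=1$ or $b=1$, Player 1 wins the Strings-and-Coins game on the complete bipartite graph $K(a,b)$ under optimal play.
   Context: Strings-and-Coins game: played on a finite graph in which every vertex initially has at least one incident edge. Two players, Player 1 moving first, alternately remove one edge. Whenever a removal leaves one or more vertices with no incident edges, the mover earns one point for each such vertex and must move again, provided edges remain. The game ends when no edges remain; a player wins if they have more points. Optimal play means each player maximizes (own final score) minus (opponent's final score). $K(a,b)$ denotes the complete bipartite graph with parts of sizes $a$ and $b$. -}

module Defs where

open import Data.Nat using (ℕ; zero; suc; _+_)
open import Data.Fin using (Fin; zero; suc; _↑ˡ_; _↑ʳ_)
open import Data.Fin.Properties using (_≟_)
open import Data.Integer using (ℤ; +_; -_; _⊔_) renaming (_+_ to _+ℤ_)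
open import Data.Product using (_×_; _,_; proj₁; proj₂)
open import Data.Bool using (Bool; true; false; _∨_; not)
open import Data.Vec using (Vec; []; _∷_; removeAt; lookup; fromList)
open import Data.List using (List; concatMap; map; length)
open import Data.List.Membership.Propositional.Properties using ()
open import Data.Fin.Base using ()
open import Relation.Nullary using (does)
open import Data.List using (allFin)

-- A finite (multi)graph on vertex set Fin n is given by a vector of edges,
-- each edge being an (unordered) pair of endpoints.
Edge : ℕ → Set
Edge n = Fin n × Fin n

incident : ∀ {n} → Fin n → Edge n → Bool
incident v (x , y) = does (v ≟ x) ∨ does (v ≟ y)

isolated : ∀ {n m} → Fin n → Vec (Edge n) m → Bool
isolated v [] = true
isolated v (e ∷ es) = not (incident v e) Data.Bool.∧ isolated v es

b2n : Bool → ℕ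
b2n true = 1
b2n false = 0

-- number of coins (vertices) completed when edge (x , y) is removed and
-- the remaining edges are es: endpoints that are now isolated
-- (a loop's single endpoint counted once).
coins : ∀ {n m} → Edge n → Vec (Edge n) m → ℕ
coins (x , y) es =
  b2n (isolated x es) + (if does (x ≟ y) then 0 else b2n (isolated y es))
  where open Data.Bool using (if_then_else_)

maxFin : ∀ m → (Fin (suc m) → ℤ) → ℤ
maxFin zero f = f zero
maxFin (suc m) f = f zero ⊔ maxFin m (λ i → f (suc i))

-- value : optimal (mover's future score − opponent's future score) from a
-- position with the given remaining edges and the mover to move.
-- Removing an edge that completes k > 0 coins gives k points and the same
-- player moves again (if edges remain; otherwise the value of [] is 0);
-- completing no coin passes the turn.
value : ∀ {n} m → Vec (Edge n) m → ℤ
value zero [] = + 0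
value (suc m) es = maxFin m option
  where
  option : Fin (suc m) → ℤ
  option i with coins (lookup es i) (removeAt es i)
  ... | zero  = - value m (removeAt es i)
  ... | suc k = + suc k +ℤ value m (removeAt es i)

Player1Wins : ∀ {n} → List (Edge n) → Set
Player1Wins es = value (length es) (fromList es) Data.Integer.> + 0

K : (a b : ℕ) → List (Edge (a + b))
K a b = concatMap (λ i → map (λ j → (i ↑ˡ b , a ↑ʳ j)) (allFin b)) (allFin a)

{-# OPTIONS --safe #-}
module Submission where

-- K(1,b) and K(a,1) are stars, and when the edges of a star are removed in
-- the order they are listed, each removal isolates the leaf of that edge.
-- If removing the first edge of a position completes k ≥ 1 coins, its value
-- is at least k plus the value of the rest; induction along the list then
-- shows that the value of a nonempty star is positive.

open import Defs
open import Data.Nat using (ℕ; zero; suc; _+_; _≥_; s≤s; z≤n)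
open import Data.Nat.Properties using (m≤n+m)
open import Data.Sum using (_⊎_; inj₁; inj₂)
open import Data.Fin using (Fin; zero; suc; _↑ˡ_; _↑ʳ_)
open import Data.Fin.Properties using (_≟_; 0≢1+n; suc-injective; ↑ˡ-injective; ↑ʳ-injective)
open import Data.Integer using (+_; _<_; _≤_; +<+)
open import Data.Integer.Properties using (i≤i⊔j; ≤-refl; <⇒≤; <-≤-trans; +-mono-<-≤)
open import Data.Vec using (Vec; []; _∷_; fromList)
open import Data.Product using (_,_)
open import Data.Bool using (true; false)
open import Data.List using (List; []; _∷_; [_]; length; map; tabulate; concat; allFin)
open import Data.List.Properties using (++-identityʳ; concat-map-[_]; map-∘; map-tabulate)
open import Function using (_∘_; id)
open import Function.Definitions using (Injective)
open import Relation.Nullary using (yes; no; contradiction)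
open import Relation.Binary.PropositionalEquality
  using (_≡_; _≢_; refl; sym; trans; cong; subst; module ≡-Reasoning)

↑ˡ≢↑ʳ : ∀ {m n} (i : Fin m) (j : Fin n) → i ↑ˡ n ≢ m ↑ʳ j
↑ˡ≢↑ʳ zero    j ()
↑ˡ≢↑ʳ (suc i) j eq = ↑ˡ≢↑ʳ i j (suc-injective eq)

value-∷-pos : ∀ {n m} (e : Edge n) (es : Vec (Edge n) m) →
              coins e es ≥ 1 → + 0 ≤ value m es → + 0 < value (suc m) (e ∷ es)
value-∷-pos {m = zero}  (x , y) [] coins≥1 value≥0 =
  +-mono-<-≤ (+<+ coins≥1) value≥0
value-∷-pos {m = suc m} (x , y) es coins≥1 value≥0 with coins (x , y) es | coins≥1
... | suc k | _ = <-≤-trans (+-mono-<-≤ (+<+ (s≤s z≤n)) value≥0) (i≤i⊔j _ _)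

data CompletesInOrder {n : ℕ} : List (Edge n) → Set where
  []  : CompletesInOrder []
  _∷_ : ∀ {e es} → coins e (fromList es) ≥ 1 → CompletesInOrder es → CompletesInOrder (e ∷ es)

value-nonneg : ∀ {n} {es : List (Edge n)} → CompletesInOrder es → + 0 ≤ value (length es) (fromList es)
value-nonneg [] = ≤-refl
value-nonneg (_∷_ {e} {es} coins≥1 complete) =
  <⇒≤ (value-∷-pos e (fromList es) coins≥1 (value-nonneg complete))

value-pos : ∀ {n} {e : Edge n} {es : List (Edge n)} →
            CompletesInOrder (e ∷ es) → + 0 < value (length (e ∷ es)) (fromList (e ∷ es))
value-pos {e = e} {es} (coins≥1 ∷ complete) = value-∷-pos e (fromList es) coins≥1 (value-nonneg complete)

coins-isolatedˡ : ∀ {n m} {x y : Fin n} (es : Vec (Edge n) m) → isolated x es ≡ true → coins (x , y) es ≥ 1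
coins-isolatedˡ es x-isolated rewrite x-isolated = s≤s z≤n

coins-isolatedʳ : ∀ {n m} {x y : Fin n} (es : Vec (Edge n) m) →
                  x ≢ y → isolated y es ≡ true → coins (x , y) es ≥ 1
coins-isolatedʳ {x = x} {y} es x≢y y-isolated with x ≟ y
... | yes x≡y = contradiction x≡y x≢y
... | no _ rewrite y-isolated = m≤n+m 1 (b2n (isolated x es))

incident-≢ : ∀ {n} {v x y : Fin n} → v ≢ x → v ≢ y → incident v (x , y) ≡ false
incident-≢ {v = v} {x} {y} v≢x v≢y with v ≟ x | v ≟ y
... | yes v≡x | _       = contradiction v≡x v≢x
... | no _    | yes v≡y = contradiction v≡y v≢y
... | no _    | no _    = refl

isolated-tabulate : ∀ {n k} (v : Fin n) (h : Fin k → Edge n) →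
                    (∀ j → incident v (h j) ≡ false) → isolated v (fromList (tabulate h)) ≡ true
isolated-tabulate {k = zero}  v h not-incident = refl
isolated-tabulate {k = suc k} v h not-incident rewrite not-incident zero =
  isolated-tabulate v (h ∘ suc) (not-incident ∘ suc)

injective⇒zero≢suc : ∀ {A : Set} {k} {f : Fin (suc k) → A} → Injective _≡_ _≡_ f → ∀ j → f zero ≢ f (suc j)
injective⇒zero≢suc f-injective j = 0≢1+n ∘ f-injective

star-leaf-first : ∀ {n k} (c : Fin n) (leaf : Fin k → Fin n) →
                  (∀ j → leaf j ≢ c) → Injective _≡_ _≡_ leaf →
                  CompletesInOrder (tabulate (λ j → (leaf j , c)))
star-leaf-first {k = zero}  c leaf leaf≢c leaf-injective = []
star-leaf-first {n} {suc k} c leaf leaf≢c leaf-injective =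
  coins-isolatedˡ (fromList (tabulate later))
    (isolated-tabulate (leaf zero) later λ j →
      incident-≢ (injective⇒zero≢suc leaf-injective j) (leaf≢c zero))
  ∷ star-leaf-first c (leaf ∘ suc) (leaf≢c ∘ suc) (suc-injective ∘ leaf-injective)
  where
  later : Fin k → Edge n
  later j = (leaf (suc j) , c)

star-centre-first : ∀ {n k} (c : Fin n) (leaf : Fin k → Fin n) →
                    (∀ j → leaf j ≢ c) → Injective _≡_ _≡_ leaf →
                    CompletesInOrder (tabulate (λ j → (c , leaf j)))
star-centre-first {k = zero}  c leaf leaf≢c leaf-injective = []
star-centre-first {n} {suc k} c leaf leaf≢c leaf-injective =
  coins-isolatedʳ (fromList (tabulate later)) (leaf≢c zero ∘ sym)
    (isolated-tabulate (leaf zero) later λ j →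
      incident-≢ (leaf≢c zero) (injective⇒zero≢suc leaf-injective j))
  ∷ star-centre-first c (leaf ∘ suc) (leaf≢c ∘ suc) (suc-injective ∘ leaf-injective)
  where
  later : Fin k → Edge n
  later j = (c , leaf (suc j))

K-1-b : ∀ b → K 1 b ≡ tabulate (λ j → (zero ↑ˡ b , 1 ↑ʳ j))
K-1-b b = trans (++-identityʳ _) (map-tabulate id _)

K-a-1 : ∀ a → K a 1 ≡ tabulate (λ i → (i ↑ˡ 1 , a ↑ʳ zero))
K-a-1 a = begin
  concat (map ([_] ∘ edge) (allFin a))  ≡⟨ cong concat (map-∘ (allFin a)) ⟩
  concat (map [_] (map edge (allFin a))) ≡⟨ concat-map-[ map edge (allFin a) ] ⟩
  map edge (allFin a)                    ≡⟨ map-tabulate id edge ⟩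
  tabulate edge                          ∎
  where
  open ≡-Reasoning
  edge : Fin a → Edge (a + 1)
  edge i = (i ↑ˡ 1 , a ↑ʳ zero)

theorem5 : (a b : ℕ) → a ≥ 1 → b ≥ 1 → (a ≡ 1 ⊎ b ≡ 1) → Player1Wins (K a b)
theorem5 a (suc b) _ _ (inj₁ refl) =
  subst Player1Wins (sym (K-1-b (suc b)))
    (value-pos (star-centre-first (centre ↑ˡ suc b) (1 ↑ʳ_) (λ j → ↑ˡ≢↑ʳ centre j ∘ sym) (↑ʳ-injective 1 _ _)))
  where
  centre : Fin 1
  centre = zero
theorem5 (suc a) b _ _ (inj₂ refl) =
  subst Player1Wins (sym (K-a-1 (suc a)))
    (value-pos (star-leaf-first (suc a ↑ʳ zero) (_↑ˡ 1) (λ i → ↑ˡ≢↑ʳ i zero) (↑ˡ-injective 1 _ _)))
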